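{- Let $n\ge1$, $C\in DC(n)$ and $(\gamma,\xi)=\Phi(C)$. Then $\gamma$ is a Dyck path of length $2n$, i.e. $\gamma=(p_0,\dots,p_{2n})$ ends at $p_{2n}=(2n,0)$ and never goes below the line $y=0$.
   Context: Dellac configurations: placements of $2n$ dots in a grid with $n$ columns (indexed $1..n$ left to right) and $2n$ rows (indexed $1..2n$ bottom to top), exactly one dot per row and two per column, each dot in column $j$, row $i$ satisfying $j\le i\le j+n$; $DC(n)$ is their set. An inversion is a pair of dots with (column,row) coordinates $(j_1,i_1),(j_2,i_2)$, $j_1<j_2$, $i_1>i_2$. Write $e_i$ for the dot in row $i$; it is even if $i\le n$ and odd if $i>n$. For $i\le n$, $l^e_C(e_i)$ is the number of inversions formed by $e_i$ and a dot $e_{i'}$ with $i<i'\le n$; for $i>n$, $r^o_C(e_i)$ is the number of inversions formed by $e_i$ and a dot $e_{i'}$ with $n<i'<i$. For $j\in[n]$, $i_1(j)<i_2(j)$ are the rows of the two dots of column $j$, and $h(j)$ is the number of even dots minus the number of odd dots in the first $j-1$ columns. The map $\Phi$: for $C\in DC(n)$, $\Phi(C)=(\gamma,\xi)$ where $\gamma=(p_0,\dots,p_{2n})$ with $p_0=(0,0)$ and each step $(1,1)$ (up) or $(1,-1)$ (down), and $\xi=(\xi_1,\dots,\xi_n)$, are built for $j=1,\dots,n$ as follows, with $i-1$ denoting the number of down steps among the first $2j-2$ steps: (1) if $i_2(j)\le n$: steps $(p_{2j-2},p_{2j-1})$ and $(p_{2j-1},p_{2j})$ are both up; (2) if $i_1(j)\le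 n<i_2(j)$: set $\xi_i=(l^e_C(e_{i_1(j)}),r^o_C(e_{i_2(j)}))$; if $l^e_C(e_{i_1(j)})>r^o_C(e_{i_2(j)})$, the step $(p_{2j-2},p_{2j-1})$ is down and $(p_{2j-1},p_{2j})$ is up; otherwise $(p_{2j-2},p_{2j-1})$ is up and $(p_{2j-1},p_{2j})$ is down; (3) if $n<i_1(j)$: both steps are down; with $2k=h(j)$ (the height of $p_{2j-2}$), let $j_m$ be the largest $j'<j$ such that $h(j'+1)=2k$ and column $j'$ contains two even dots (such $j'$ exists), and set $\xi_i=(l^e_C(e_{i_1(j_m)}),l^e_C(e_{i_2(j_m)}))$, $\xi_{i+1}=(r^o_C(e_{i_1(j)}),r^o_C(e_{i_2(j)}))$. -}

module Defs where

open import Data.Nat using (ℕ; zero; suc; _+_; _*_; _≤_; _<_; _<ᵇ_; _≡ᵇ_)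
open import Data.Bool using (Bool; true; false; _∧_; _∨_; if_then_else_)
open import Data.Fin using (Fin; toℕ)
open import Data.Fin.Properties using (_≟_)
open import Data.List using (List; []; _∷_; length; filter; filterᵇ; concatMap; last)
open import Data.List.Relation.Unary.All using (All)
open import Data.Fin.Base using () renaming (_<_ to _<ᶠ_)
open import Data.List.Base using ()
open import Data.Integer using (ℤ; +_; -[1+_]) renaming (_+_ to _+ℤ_; _≤_ to _≤ℤ_)
open import Data.Product using (_×_; _,_; proj₂)
open import Data.Maybe using (Maybe; just)
open import Relation.Binary.PropositionalEquality using (_≡_)
open import Data.List.Base using () renaming (tabulate to tab)

-- Fin-row r corresponds to paper row i = toℕ r + 1 (rows 1..2n);
-- Fin-column c corresponds to paper column j = toℕ c + 1 (columns 1..n).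
-- A configuration assigns to each row the column of its (unique) dot.

allRows : (n : ℕ) → List (Fin (2 * n))
allRows n = tab (λ r → r)

allCols : (n : ℕ) → List (Fin n)
allCols n = tab (λ c → c)

record DC (n : ℕ) : Set where
  field
    col : Fin (2 * n) → Fin n
    inRange : ∀ (r : Fin (2 * n)) → toℕ (col r) ≤ toℕ r × toℕ r ≤ toℕ (col r) + n
    twoPerCol : ∀ (c : Fin n) → length (filter (λ r → col r ≟ c) (allRows n)) ≡ 2
open DC public

module _ {n : ℕ} (C : DC n) where

  rowsOf : Fin n → List (Fin (2 * n))
  rowsOf c = filter (λ r → col C r ≟ c) (allRows n)

  -- dot e_i is even iff i ≤ n, i.e. toℕ r < n
  isEven : Fin (2 * n) → Bool
  isEven r = toℕ r <ᵇ n

  inv : Fin (2 * n) → Fin (2 * n) → Bool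
  inv a b = ((toℕ (col C a) <ᵇ toℕ (col C b)) ∧ (toℕ b <ᵇ toℕ a))
          ∨ ((toℕ (col C b) <ᵇ toℕ (col C a)) ∧ (toℕ a <ᵇ toℕ b))

  lE : Fin (2 * n) → ℕ
  lE a = length (filterᵇ (λ b → (toℕ a <ᵇ toℕ b) ∧ (toℕ b <ᵇ n) ∧ inv a b) (allRows n))

  rO : Fin (2 * n) → ℕ
  rO a = length (filterᵇ (λ b → (n Data.Nat.≤ᵇ toℕ b) ∧ (toℕ b <ᵇ toℕ a) ∧ inv a b) (allRows n))

data Step : Set where
  up down : Step

stepVal : Step → ℤ
stepVal up = + 1
stepVal down = -[1+ 0 ]

module _ {n : ℕ} (C : DC n) where

  colSteps : Fin n → List Step
  colSteps c with rowsOf C c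
  ... | a ∷ b ∷ [] =
        if isEven C b then up ∷ up ∷ []
        else if isEven C a then
          (if rO C b <ᵇ lE C a then down ∷ up ∷ [] else up ∷ down ∷ [])
        else down ∷ down ∷ []
  ... | _ = []   -- impossible by twoPerCol

  stepsΦ : List Step
  stepsΦ = concatMap colSteps (allCols n)

pathFrom : ℕ → ℤ → List Step → List (ℕ × ℤ)
pathFrom k h [] = (k , h) ∷ []
pathFrom k h (s ∷ ss) = (k , h) ∷ pathFrom (suc k) (h +ℤ stepVal s) ss

Φγ : ∀ {n} → DC n → List (ℕ × ℤ)
Φγ C = pathFrom 0 (+ 0) (stepsΦ C)

IsDyckPath : ℕ → List (ℕ × ℤ) → Set
IsDyckPath m γ = (last γ ≡ just (m , + 0)) × All (λ p → + 0 ≤ℤ proj₂ p) γ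

module Submission where

-- Φ(C) builds γ two steps per column, so it suffices to know the height of γ
-- after each block.  Let E(j) be the number of even dots in the first j
-- columns.  A column with 2, 1 or 0 even dots contributes up-up, a mixed pair
-- or down-down, so after the first j columns γ has height 2(E(j) - j).
--
-- Two counting facts about Dellac configurations make this a Dyck path:
--   * j ≤ E(j) for j ≤ n, since every dot in rows 1..j is even and lies in
--     the first j columns (a dot in row i sits in a column ≤ i); and
--     E(0) = 0, E(n) = n;
--   * in case (2) with a "down-up" block the height before the column is
--     positive: l^e_C(e_{i₁}) > 0 yields an even dot above e_{i₁} and to its
--     left, which is counted by E(j) but lies in no row ≤ j, so E(j) > j.

open import Defs
open import Data.Nat using (ℕ; zero; suc; _+_; _*_; _∸_; _≤_; _<_; _<ᵇ_; _⊓_; z≤n)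
open import Data.Nat.Properties hiding (_≟_)
open import Algebra.Properties.CommutativeSemigroup +-commutativeSemigroup using (interchange)
open import Data.Bool using (Bool; true; false; T; _∧_; _∨_; if_then_else_)
open import Data.Bool.Properties using (T-∧; T-∨)
open import Data.Unit using (tt)
open import Data.Empty using (⊥-elim)
open import Data.Fin using (Fin; toℕ) renaming (zero to fzero; suc to fsuc)
open import Data.Fin.Properties using (toℕ<n; toℕ-injective; _≟_)
open import Data.List using (List; []; _∷_; _++_; length; map; concat; filter; filterᵇ; last; tabulate; allFin)
open import Data.List.Properties using (map-tabulate; length-++)
open import Data.List.Relation.Unary.All using (All; []; _∷_)
open import Data.List.Relation.Unary.Any using (here; there)
open import Data.List.Relation.Unary.AllPairs using (AllPairs; _∷_)
import Data.List.Relation.Unary.AllPairs.Properties as AllPairs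
open import Data.List.Membership.Propositional using (_∈_)
open import Data.List.Membership.Propositional.Properties using (∈-filter⁻; ∈-allFin)
open import Data.Integer using (ℤ; +_; +≤+) renaming (_+_ to _+ℤ_; _≤_ to _≤ℤ_)
open import Data.Integer.Properties using ([1+m]⊖[1+n]≡m⊖n; ⊖-≥)
open import Data.Product using (_×_; _,_; proj₁; proj₂; Σ-syntax)
open import Data.Sum using (_⊎_; inj₁; inj₂)
open import Data.Maybe using (just)
open import Function using (_∘_; id)
open import Function.Bundles using (Equivalence)
open import Relation.Nullary using (¬_; does; yes; no)
open import Relation.Unary using (Decidable)
open import Relation.Binary.PropositionalEquality

private
  variable
    A B : Set
    a b : Bool

<ᵇ-suc-self : ∀ m → (m <ᵇ suc m) ≡ true
<ᵇ-suc-self zero    = refl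
<ᵇ-suc-self (suc m) = <ᵇ-suc-self m

<ᵇ-self : ∀ m → (m <ᵇ m) ≡ false
<ᵇ-self zero    = refl
<ᵇ-self (suc m) = <ᵇ-self m

<ᵇ-suc-≢ : ∀ {m j} → m ≢ j → (m <ᵇ suc j) ≡ (m <ᵇ j)
<ᵇ-suc-≢ {zero}  {zero}  m≢j = ⊥-elim (m≢j refl)
<ᵇ-suc-≢ {zero}  {suc j} _   = refl
<ᵇ-suc-≢ {suc m} {zero}  _   = refl
<ᵇ-suc-≢ {suc m} {suc j} m≢j = <ᵇ-suc-≢ (m≢j ∘ cong suc)

∸-pred : ∀ {e j} → suc j ≤ e → e ∸ j ≡ suc (e ∸ suc j)
∸-pred {e} = +-∸-assoc 1 {e}

T-∧-intro : T a → T b → T (a ∧ b)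
T-∧-intro ta tb = Equivalence.from T-∧ (ta , tb)

-- (The Booleans are explicit: _∧_ and _∨_ are not injective.)
T-∧-elim : ∀ a b → T (a ∧ b) → T a × T b
T-∧-elim a b = Equivalence.to (T-∧ {a} {b})

T-∨-elim : ∀ a b → T (a ∨ b) → T a ⊎ T b
T-∨-elim a b = Equivalence.to (T-∨ {a} {b})

𝟙 : Bool → ℕ
𝟙 true  = 1
𝟙 false = 0

count : (A → Bool) → List A → ℕ
count p []       = 0
count p (x ∷ xs) = 𝟙 (p x) + count p xs

𝟙-mono : (T a → T b) → 𝟙 a ≤ 𝟙 b
𝟙-mono {false}         _   = z≤n
𝟙-mono {true} {true}   _   = ≤-refl
𝟙-mono {true} {false}  a⇒b = ⊥-elim (a⇒b tt)

𝟙-strict : ¬ T a → T b → 𝟙 a < 𝟙 b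
𝟙-strict {false} {true} _  _ = ≤-refl
𝟙-strict {true}         ¬a _ = ⊥-elim (¬a tt)

count-mono : (p q : A → Bool) → (∀ x → T (p x) → T (q x)) → ∀ xs → count p xs ≤ count q xs
count-mono p q p⇒q []       = z≤n
count-mono p q p⇒q (x ∷ xs) = +-mono-≤ (𝟙-mono (p⇒q x)) (count-mono p q p⇒q xs)

count-strict : (p q : A → Bool) → (∀ x → T (p x) → T (q x)) → ∀ {y xs} → y ∈ xs →
               ¬ T (p y) → T (q y) → count p xs < count q xs
count-strict p q p⇒q {xs = x ∷ xs} (here refl) ¬py qy =
  +-mono-<-≤ (𝟙-strict ¬py qy) (count-mono p q p⇒q xs)
count-strict p q p⇒q {xs = x ∷ xs} (there y∈xs) ¬py qy =
  +-mono-≤-< (𝟙-mono (p⇒q x)) (count-strict p q p⇒q y∈xs ¬py qy)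

count-split : (p q r : A → Bool) → (∀ x → 𝟙 (p x) ≡ 𝟙 (q x) + 𝟙 (r x)) →
              ∀ xs → count p xs ≡ count q xs + count r xs
count-split p q r split []       = refl
count-split p q r split (x ∷ xs) = begin
  𝟙 (p x) + count p xs                          ≡⟨ cong₂ _+_ (split x) (count-split p q r split xs) ⟩
  (𝟙 (q x) + 𝟙 (r x)) + (count q xs + count r xs) ≡⟨ interchange (𝟙 (q x)) (𝟙 (r x)) _ _ ⟩
  (𝟙 (q x) + count q xs) + (𝟙 (r x) + count r xs) ∎
  where open ≡-Reasoning

count-filter : {P : A → Set} (P? : Decidable P) (p : A → Bool) → ∀ xs →
               count p (filter P? xs) ≡ count (λ x → does (P? x) ∧ p x) xs
count-filter P? p []       = refl
count-filter P? p (x ∷ xs) with does (P? x)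
... | true  = cong (_+_ (𝟙 (p x))) (count-filter P? p xs)
... | false = count-filter P? p xs

count-map : (p : B → Bool) (f : A → B) → ∀ xs → count p (map f xs) ≡ count (p ∘ f) xs
count-map p f []       = refl
count-map p f (x ∷ xs) = cong (_+_ (𝟙 (p (f x)))) (count-map p f xs)

filterᵇ-witness : (p : A → Bool) (xs : List A) → 0 < length (filterᵇ p xs) →
                  Σ[ x ∈ A ] x ∈ xs × T (p x)
filterᵇ-witness p (x ∷ xs) len>0 with p x in px
... | true  = x , here refl , subst T (sym px) tt
... | false with filterᵇ-witness p xs len>0
...   | y , y∈xs , py = y , there y∈xs , py

count-below : ∀ m B → count (λ i → toℕ i <ᵇ B) (allFin m) ≡ B ⊓ m
count-below zero    B = sym (⊓-zeroʳ B)
count-below (suc m) B = begin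
  𝟙 (0 <ᵇ B) + count (λ i → toℕ i <ᵇ B) (tabulate {n = m} fsuc)
    ≡⟨ cong (λ is → 𝟙 (0 <ᵇ B) + count (λ i → toℕ i <ᵇ B) is) (sym (map-tabulate {n = m} id fsuc)) ⟩
  𝟙 (0 <ᵇ B) + count (λ i → toℕ i <ᵇ B) (map fsuc (allFin m))
    ≡⟨ cong (_+_ (𝟙 (0 <ᵇ B))) (count-map (λ i → toℕ i <ᵇ B) fsuc (allFin m)) ⟩
  𝟙 (0 <ᵇ B) + count (λ i → suc (toℕ i) <ᵇ B) (allFin m)
    ≡⟨ shift B ⟩
  B ⊓ suc m ∎
  where
  open ≡-Reasoning
  shift : ∀ B → 𝟙 (0 <ᵇ B) + count (λ i → suc (toℕ i) <ᵇ B) (allFin m) ≡ B ⊓ suc m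
  shift zero    = count-below m zero
  shift (suc B) = cong suc (count-below m B)

-- A single step between two ℕ-valued heights, and a walk that never leaves
-- ℕ: the height after every step of a 'Walk' is again a natural number.
data _⟶[_]_ : ℕ → Step → ℕ → Set where
  ascend  : ∀ {h} → h ⟶[ up ] suc h
  descend : ∀ {h} → suc h ⟶[ down ] h

infixr 5 _▸_
data Walk : ℕ → List Step → ℕ → Set where
  stop : ∀ {h} → Walk h [] h
  _▸_  : ∀ {h h′ h″ s ss} → h ⟶[ s ] h′ → Walk h′ ss h″ → Walk h (s ∷ ss) h″

step-height : ∀ {h h′ s} → h ⟶[ s ] h′ → + h +ℤ stepVal s ≡ + h′
step-height (ascend {h})  = cong +_ (+-comm h 1)
step-height (descend {h}) = trans ([1+m]⊖[1+n]≡m⊖n h 0) (⊖-≥ z≤n)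

walk-++ : ∀ {h h′ h″ xs ys} → Walk h xs h′ → Walk h′ ys h″ → Walk h (xs ++ ys) h″
walk-++ stop       w = w
walk-++ (s ▸ w₁) w₂ = s ▸ walk-++ w₁ w₂

-- 'pathFrom' is never empty, so prepending a point does not change its end.
last-pathFrom : ∀ (p : ℕ × ℤ) k h ss → last (p ∷ pathFrom k h ss) ≡ last (pathFrom k h ss)
last-pathFrom p k h []      = refl
last-pathFrom p k h (_ ∷ _) = refl

walk-path : ∀ {h h′ ss} → Walk h ss h′ → ∀ k →
            All (λ p → + 0 ≤ℤ proj₂ p) (pathFrom k (+ h) ss) ×
            last (pathFrom k (+ h) ss) ≡ just (k + length ss , + h′)
walk-path {h} stop k = +≤+ z≤n ∷ [] , cong (λ x → just (x , + h)) (sym (+-identityʳ k))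
walk-path {h} {h″} {s ∷ ss} (_▸_ {h′ = h′} step w) k
  rewrite step-height step with walk-path w (suc k)
... | above , ends = +≤+ z≤n ∷ above ,
  trans (last-pathFrom (k , + h) (suc k) (+ h′) ss)
        (trans ends (cong (λ x → just (x , + h″)) (sym (+-suc k (length ss)))))

walk-concat : ∀ m ℓ (H : ℕ → ℕ) (blk : Fin m → List Step) →
              (∀ i → Walk (H (toℕ i)) (blk i) (H (suc (toℕ i))) × length (blk i) ≡ ℓ) →
              Walk (H 0) (concat (tabulate blk)) (H m) × length (concat (tabulate blk)) ≡ m * ℓ
walk-concat zero    ℓ H blk blocks = stop , refl
walk-concat (suc m) ℓ H blk blocks with blocks fzero | walk-concat m ℓ (H ∘ suc) (blk ∘ fsuc) (blocks ∘ fsuc)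
... | w₀ , len₀ | w , len =
  walk-++ w₀ w , trans (length-++ (blk fzero)) (cong₂ _+_ len₀ len)

rise : ∀ d → Walk (2 * d) (up ∷ up ∷ []) (2 * suc d)
rise d = subst (Walk (2 * d) (up ∷ up ∷ [])) (sym (*-suc 2 d)) (ascend ▸ ascend ▸ stop)

fall : ∀ d → Walk (2 * suc d) (down ∷ down ∷ []) (2 * d)
fall d = subst (λ h → Walk h (down ∷ down ∷ []) (2 * d)) (sym (*-suc 2 d)) (descend ▸ descend ▸ stop)

peak : ∀ d → Walk (2 * d) (up ∷ down ∷ []) (2 * d)
peak d = ascend ▸ descend ▸ stop

valley : ∀ d → Walk (2 * suc d) (down ∷ up ∷ []) (2 * suc d)
valley d = descend ▸ ascend ▸ stop

retarget : ∀ {h ss d d′} → d ≡ d′ → Walk h ss (2 * d) → Walk h ss (2 * d′)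
retarget refl w = w

restart : ∀ {h ss d d′} → d ≡ d′ → Walk (2 * d) ss h → Walk (2 * d′) ss h
restart refl w = w

module _ {n : ℕ} (C : DC n) where

  inFirstColumns : ℕ → Fin (2 * n) → Bool
  inFirstColumns j r = (toℕ (col C r) <ᵇ j) ∧ isEven C r

  evensBefore : ℕ → ℕ
  evensBefore j = count (inFirstColumns j) (allFin (2 * n))

  n≤2n : n ≤ 2 * n
  n≤2n = m≤m+n n (n + 0)

  rows-below : ∀ j → j ≤ 2 * n → count (λ r → toℕ r <ᵇ j) (allFin (2 * n)) ≡ j
  rows-below j j≤2n = trans (count-below (2 * n) j) (m≤n⇒m⊓n≡m j≤2n)

  -- For j ≤ n, each of the dots in the first j rows is even and, as a dot in
  -- row i lies in a column ≤ i, sits in the first j columns.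
  low-rows-counted : ∀ {j} → j ≤ n → ∀ r → T (toℕ r <ᵇ j) → T (inFirstColumns j r)
  low-rows-counted j≤n r r<ᵇj =
    T-∧-intro (<⇒<ᵇ (≤-<-trans (proj₁ (inRange C r)) r<j)) (<⇒<ᵇ (<-≤-trans r<j j≤n))
    where r<j = <ᵇ⇒< _ _ r<ᵇj

  evensBefore-lower : ∀ {j} → j ≤ n → j ≤ evensBefore j
  evensBefore-lower {j} j≤n = subst (_≤ evensBefore j) (rows-below j (≤-trans j≤n n≤2n))
    (count-mono _ _ (low-rows-counted j≤n) (allFin (2 * n)))

  evensBefore-strict : ∀ {j} → j ≤ n → ∀ r → T (inFirstColumns j r) → j ≤ toℕ r →
                       suc j ≤ evensBefore j
  evensBefore-strict {j} j≤n r counted j≤r = subst (λ x → suc x ≤ evensBefore j)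
    (rows-below j (≤-trans j≤n n≤2n))
    (count-strict _ _ (low-rows-counted j≤n) (∈-allFin r) (λ r<j → <⇒≱ (<ᵇ⇒< _ _ r<j) j≤r) counted)

  evensBefore-zero : evensBefore 0 ≡ 0
  evensBefore-zero = count-below (2 * n) 0

  -- There are only n even dots.
  evensBefore-all : evensBefore n ≤ n
  evensBefore-all = subst (evensBefore n ≤_) (rows-below n n≤2n)
    (count-mono _ _ (λ r → proj₂ ∘ T-∧-elim (toℕ (col C r) <ᵇ n) (isEven C r)) (allFin (2 * n)))

  evensBefore-step : ∀ (c : Fin n) →
    evensBefore (suc (toℕ c)) ≡ evensBefore (toℕ c) + count (isEven C) (rowsOf C c)
  evensBefore-step c = trans
    (count-split _ _ (λ r → does (col C r ≟ c) ∧ isEven C r) split (allFin (2 * n)))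
    (cong (_+_ (evensBefore (toℕ c))) (sym (count-filter (λ r → col C r ≟ c) (isEven C) (allFin (2 * n)))))
    where
    split : ∀ r → 𝟙 (inFirstColumns (suc (toℕ c)) r) ≡
                  𝟙 (inFirstColumns (toℕ c) r) + 𝟙 (does (col C r ≟ c) ∧ isEven C r)
    split r with col C r ≟ c
    ... | yes refl rewrite <ᵇ-suc-self (toℕ c) | <ᵇ-self (toℕ c) = refl
    ... | no col≢c rewrite <ᵇ-suc-≢ (col≢c ∘ toℕ-injective) =
          sym (+-identityʳ (𝟙 (inFirstColumns (toℕ c) r)))

  -- The surplus E(j) - j; γ has height 2 · surplus j after the first j columns.
  surplus : ℕ → ℕ
  surplus j = evensBefore j ∸ j

  surplus-grows : ∀ {j} k → j ≤ n → evensBefore (suc j) ≡ evensBefore j + suc k →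
                  surplus (suc j) ≡ k + surplus j
  surplus-grows {j} k j≤n step = begin
    evensBefore (suc j) ∸ suc j  ≡⟨ cong (_∸ suc j) (trans step (+-suc (evensBefore j) k)) ⟩
    (evensBefore j + k) ∸ j      ≡⟨ +-∸-comm k (evensBefore-lower j≤n) ⟩
    surplus j + k                ≡⟨ +-comm (surplus j) k ⟩
    k + surplus j                ∎
    where open ≡-Reasoning

  surplus-drops : ∀ {j} → suc j ≤ n → evensBefore (suc j) ≡ evensBefore j + 0 →
                  surplus j ≡ suc (surplus (suc j))
  surplus-drops {j} j<n step = trans (∸-pred (subst (suc j ≤_) E≡ (evensBefore-lower j<n)))
                                      (cong (λ e → suc (e ∸ suc j)) (sym E≡))
    where E≡ = trans step (+-identityʳ (evensBefore j))

  column-rows : ∀ c {a b} → rowsOf C c ≡ a ∷ b ∷ [] → col C a ≡ c × toℕ a < toℕ b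
  column-rows c {a} {b} rows≡ =
    proj₂ (∈-filter⁻ inColumn {xs = allFin (2 * n)} (subst (a ∈_) (sym rows≡) (here refl))) ,
    a<b sorted
    where
    inColumn : Decidable (λ r → col C r ≡ c)
    inColumn r = col C r ≟ c
    sorted : AllPairs (λ x y → toℕ x < toℕ y) (a ∷ b ∷ [])
    sorted = subst (AllPairs _) rows≡ (AllPairs.filter⁺ inColumn (AllPairs.tabulate⁺-< id))
    a<b : AllPairs (λ x y → toℕ x < toℕ y) (a ∷ b ∷ []) → toℕ a < toℕ b
    a<b ((a<b ∷ _) ∷ _) = a<b

  inversion-left : ∀ a b → toℕ a < toℕ b → T (inv C a b) → toℕ (col C b) < toℕ (col C a)
  inversion-left a b a<b inverted
    with T-∨-elim ((toℕ (col C a) <ᵇ toℕ (col C b)) ∧ (toℕ b <ᵇ toℕ a))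
                  ((toℕ (col C b) <ᵇ toℕ (col C a)) ∧ (toℕ a <ᵇ toℕ b)) inverted
  ... | inj₁ b-right = ⊥-elim (<-asym a<b
          (<ᵇ⇒< _ _ (proj₂ (T-∧-elim (toℕ (col C a) <ᵇ toℕ (col C b)) _ b-right))))
  ... | inj₂ b-left = <ᵇ⇒< _ _ (proj₁ (T-∧-elim (toℕ (col C b) <ᵇ toℕ (col C a)) _ b-left))

  inversion-witness : ∀ a → 0 < lE C a →
    Σ[ b ∈ Fin (2 * n) ] toℕ a < toℕ b × T (isEven C b) × toℕ (col C b) < toℕ (col C a)
  inversion-witness a lE>0 with filterᵇ-witness _ (allFin (2 * n)) lE>0
  ... | b , _ , counted
    with T-∧-elim (toℕ a <ᵇ toℕ b) ((toℕ b <ᵇ n) ∧ inv C a b) counted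
  ... | a<ᵇb , even∧inv with T-∧-elim (toℕ b <ᵇ n) (inv C a b) even∧inv
  ... | even , inverted = b , a<b , even , inversion-left a b a<b inverted
    where a<b = <ᵇ⇒< (toℕ a) (toℕ b) a<ᵇb

  columnSteps : Fin (2 * n) → Fin (2 * n) → List Step
  columnSteps a b =
    if isEven C b then up ∷ up ∷ []
    else if isEven C a then (if rO C b <ᵇ lE C a then down ∷ up ∷ [] else up ∷ down ∷ [])
    else down ∷ down ∷ []

  -- In the mixed case with l^e_C(e_a) > r^o_C(e_b) ≥ 0, the inversion witness is
  -- an even dot of an earlier column above row j, so the surplus is positive.
  surplus-positive : ∀ (c : Fin n) a → col C a ≡ c → 0 < lE C a →
                     surplus (toℕ c) ≡ suc (evensBefore (toℕ c) ∸ suc (toℕ c))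
  surplus-positive c a col-a lE>0 with inversion-witness a lE>0
  ... | b , a<b , b-even , b-left = ∸-pred (evensBefore-strict j≤n b counted j≤b)
    where
    j≤n : toℕ c ≤ n
    j≤n = <⇒≤ (toℕ<n c)
    counted : T (inFirstColumns (toℕ c) b)
    counted = T-∧-intro (<⇒<ᵇ (subst (λ c′ → toℕ (col C b) < toℕ c′) col-a b-left)) b-even
    j≤b : toℕ c ≤ toℕ b
    j≤b = subst (λ c′ → toℕ c′ ≤ toℕ b) col-a (<⇒≤ (≤-<-trans (proj₁ (inRange C a)) a<b))

  pair-walk : ∀ (c : Fin n) a b → col C a ≡ c → toℕ a < toℕ b →
    evensBefore (suc (toℕ c)) ≡ evensBefore (toℕ c) + count (isEven C) (a ∷ b ∷ []) →
    Walk (2 * surplus (toℕ c)) (columnSteps a b) (2 * surplus (suc (toℕ c)))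
  pair-walk c a b col-a a<b step with isEven C b in b-even | isEven C a in a-even
  ... | true | false =   -- impossible: a lies below the even dot b
    ⊥-elim (subst T a-even (<⇒<ᵇ (<-trans a<b (<ᵇ⇒< (toℕ b) n (subst T (sym b-even) tt)))))
  ... | true | true = retarget (sym (surplus-grows 1 (<⇒≤ (toℕ<n c)) step)) (rise (surplus (toℕ c)))
  ... | false | false = restart (sym (surplus-drops (toℕ<n c) step)) (fall (surplus (suc (toℕ c))))
  ... | false | true with rO C b <ᵇ lE C a in left-heavy
  ...   | false = retarget (sym unchanged) (peak (surplus (toℕ c)))
    where unchanged = surplus-grows 0 (<⇒≤ (toℕ<n c)) step
  ...   | true = retarget (trans (sym positive) (sym unchanged)) (restart (sym positive) (valley _))
    where
    unchanged = surplus-grows 0 (<⇒≤ (toℕ<n c)) step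
    positive = surplus-positive c a col-a
                 (≤-<-trans z≤n (<ᵇ⇒< _ _ (subst T (sym left-heavy) tt)))

  columnSteps-length : ∀ a b → length (columnSteps a b) ≡ 2
  columnSteps-length a b with isEven C b | isEven C a | rO C b <ᵇ lE C a
  ... | true  | _     | _     = refl
  ... | false | true  | true  = refl
  ... | false | true  | false = refl
  ... | false | false | _     = refl

  column-walk : ∀ (c : Fin n) →
    Walk (2 * surplus (toℕ c)) (colSteps C c) (2 * surplus (suc (toℕ c))) × length (colSteps C c) ≡ 2
  column-walk c with rowsOf C c in rows≡ | twoPerCol C c | evensBefore-step c
  ... | []             | () | _
  ... | _ ∷ []         | () | _
  ... | _ ∷ _ ∷ _ ∷ _  | () | _
  ... | a ∷ b ∷ []     | _  | step with column-rows c rows≡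
  ...   | col-a , a<b = pair-walk c a b col-a a<b step , columnSteps-length a b

  steps-walk : Walk 0 (stepsΦ C) 0 × length (stepsΦ C) ≡ 2 * n
  steps-walk with walk-concat n 2 (λ j → 2 * surplus j) (colSteps C) column-walk
  ... | walk , len = subst (λ ss → Walk 0 ss 0 × length ss ≡ 2 * n) (sym steps≡)
                       (restart evensBefore-zero (retarget surplus-end walk) , trans len (*-comm n 2))
    where
    steps≡ : stepsΦ C ≡ concat (tabulate (colSteps C))
    steps≡ = cong concat (map-tabulate id (colSteps C))
    surplus-end : surplus n ≡ 0
    surplus-end = m≤n⇒m∸n≡0 evensBefore-all

proposition8 : ∀ (n : ℕ) → 1 ≤ n → (C : DC n) → IsDyckPath (2 * n) (Φγ C)
proposition8 n _ C with steps-walk C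
... | walk , length≡2n with walk-path walk 0
... | above , ends = subst (λ m → last (Φγ C) ≡ just (m , + 0)) length≡2n ends , above
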